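{- For every $k\in\mathbb{N}=\{1,2,\dots\}$ and every $k$-local word $w$, the graph $\mathcal{G}(w)$ represented by $w$ is $(k+1)$-representable.
   Context: For a word $w$ over an alphabet $\Sigma$, $\mathrm{alph}(w)$ is the set of letters occurring in $w$, and $|w|_{\mathtt a}$ is the number of occurrences of $\mathtt a$ in $w$. For $S\subseteq\Sigma$, $\pi_S$ is the projection morphism deleting all letters not in $S$. Two distinct letters $\mathtt a,\mathtt b$ alternate in $w$ if $\pi_{\{\mathtt a,\mathtt b\}}(w)$ is one of $(\mathtt{ab})^n$, $(\mathtt{ab})^n\mathtt a$, $(\mathtt{ba})^n$, $(\mathtt{ba})^n\mathtt b$ for some $n\in\mathbb{N}$. A graph $G=(V,E)$ is represented by $w$ if $\mathrm{alph}(w)=V$ and for all $\mathtt a,\mathtt b\in V$: $\mathtt a,\mathtt b$ alternate in $w$ iff $\{\mathtt a,\mathtt b\}\in E$; $\mathcal G(w)$ denotes the graph represented by $w$. A word is $k$-uniform if every letter of $\mathrm{alph}(w)$ occurs exactly $k$ times; a graph is $k$-representable if some $k$-uniform word represents it. Locality: a marking sequence for $w$ is an enumeration $\sigma=(\mathtt a_1,\dots,\mathtt a_n)$ of the distinct letters of $w$. At stage $i$, the marked version $w_i$ of $w$ is obtained by marking every occurrence in $w$ of each of $\mathtt a_1,\dots,\mathtt a_i$; a marked block is a maximal factor consisting of consecutive marked positions. The word $w$ is $k$-local if there is a marking sequence such that at every stage $i$ the marked version $w_i$ has at most $k$ marked blocks. -}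

module Defs where

open import Data.Nat using (ℕ; zero; suc; _≤_)
open import Data.Bool using (Bool; true; false)
open import Data.List using (List; []; _∷_; _++_; [_]; length; filter; map; take)
open import Data.List.Membership.Propositional using (_∈_)
open import Data.List.Relation.Unary.Any using (any?)
open import Data.List.Relation.Unary.Unique.Propositional using (Unique)
open import Data.Product using (Σ; ∃; ∃-syntax; _×_; _,_)
open import Data.Sum using (_⊎_)
open import Function.Bundles using (_⇔_)
open import Relation.Nullary using (¬_; Dec; does)
open import Relation.Nullary.Decidable using (_⊎-dec_)
open import Relation.Binary.PropositionalEquality using (_≡_)
open import Relation.Binary.Definitions using (DecidableEquality)
import Level
open Level using (Level)

module Words {a : Level} {A : Set a} (_≟_ : DecidableEquality A) where

  count : A → List A → ℕ
  count x w = length (filter (λ y → x ≟ y) w)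

  proj₂ : A → A → List A → List A
  proj₂ x y w = filter (λ z → (x ≟ z) ⊎-dec (y ≟ z)) w

  pow : A → A → ℕ → List A
  pow x y zero    = []
  pow x y (suc n) = x ∷ y ∷ pow x y n

  Alternate : A → A → List A → Set a
  Alternate x y w = ¬ (x ≡ y) × ∃[ n ]
      ( proj₂ x y w ≡ pow x y n
      ⊎ proj₂ x y w ≡ pow x y n ++ [ x ]
      ⊎ proj₂ x y w ≡ pow y x n
      ⊎ proj₂ x y w ≡ pow y x n ++ [ y ])

  -- A graph with vertex set V ⊆ A and edge relation E (E x y encodes {x,y} ∈ E).
  record Graph : Set (Level.suc a) where
    field
      V : A → Set a
      E : A → A → Set a

  Represents : List A → Graph → Set a
  Represents w G = (∀ x → (x ∈ w) ⇔ Graph.V G x)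
                 × (∀ x y → Graph.V G x → Graph.V G y → (Alternate x y w ⇔ Graph.E G x y))

  𝒢 : List A → Graph
  𝒢 w = record { V = λ x → x ∈ w ; E = λ x y → Alternate x y w }

  Uniform : ℕ → List A → Set a
  Uniform k w = ∀ x → x ∈ w → count x w ≡ k

  Representable : ℕ → Graph → Set a
  Representable k G = ∃[ u ] (Uniform k u × Represents u G)

  MarkingSequence : List A → List A → Set a
  MarkingSequence w σ = Unique σ × (∀ x → (x ∈ σ) ⇔ (x ∈ w))

  -- number of maximal runs of `true` in a Bool list; the flag records
  -- whether the previous position was marked
  runs : Bool → List Bool → ℕ
  runs _     []           = zero
  runs _     (false ∷ bs) = runs false bs
  runs true  (true ∷ bs)  = runs true bs
  runs false (true ∷ bs)  = suc (runs true bs)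

  markedBlocks : List A → List A → ℕ
  markedBlocks m w = runs false (map (λ x → does (any? (λ y → x ≟ y) m)) w)

  Local : ℕ → List A → Set a
  Local k w = ∃[ σ ] (MarkingSequence w σ
                × (∀ i → i ≤ length σ → markedBlocks (take i σ) w ≤ k))

-- Two letters alternate exactly when the projection of the word onto them has no two equal
-- adjacent letters.  If x and y alternate and some prefix of the marking sequence marks x but
-- not y, then consecutive occurrences of x are separated by the unmarked y, so each occurrence
-- of x is its own marked block and x occurs at most k times; y then occurs at most k + 1 times.
-- Letters that alternate with no other letter are collected into factors zz, which alternate
-- with nothing.  What remains is padding: repeatedly prepend the deficient letter whose first
-- occurrence is latest.  A deficient partner occurs before it and a saturated partner occurs
-- more often, so in both cases the partner leads the projection and alternation is unchanged.
module Submission where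

open import Defs
open import Level using (Level; _⊔_)
open import Data.Nat using (ℕ; zero; suc; _+_; _≤_; _<_; _≥_; _∸_; z≤n; s≤s; _<?_)
open import Data.Nat.Properties
open import Data.Nat.Induction using (<-wellFounded)
open import Data.Nat.ListAction using (sum)
open import Induction.WellFounded using (Acc; acc)
open import Data.Bool using (Bool; true; false)
open import Data.Maybe using (just)
open import Data.Maybe.Relation.Binary.Connected using (Connected; just; just-nothing)
open import Data.List
  using (List; []; _∷_; _++_; [_]; concatMap; deduplicate; head; length; filter; map; take)
open import Data.List.Properties
  using (filter-accept; filter-reject; filter-++; filter-≐; filter-none; length-++; ++-identityʳ; ++-assoc)
open import Data.List.Relation.Unary.All as All using (All; []; _∷_)
open import Data.List.Relation.Unary.All.Properties using (all-filter; ¬Any⇒All¬; All¬⇒¬Any)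
open import Data.List.Relation.Unary.Any as Any using (Any; here; there; any?)
open import Data.List.Relation.Unary.AllPairs using ([]; _∷_)
open import Data.List.Relation.Unary.Linked as Linked using (Linked; []; [-]; _∷_; _∷′_)
open import Data.List.Relation.Unary.Unique.Propositional using (Unique)
import Data.List.Relation.Unary.Unique.DecPropositional.Properties as Unique
open import Data.List.Relation.Binary.Sublist.Propositional using (_⊆_; []; _∷_; _∷ʳ_)
open import Data.List.Relation.Binary.Sublist.Propositional.Properties using (filter-⊆; map⁺)
open import Data.List.Membership.Propositional using (_∈_; _∉_; lose; find)
open import Data.List.Membership.Propositional.Properties
  using (∈-++⁺ˡ; ∈-++⁺ʳ; ∈-++⁻; ∈-concatMap⁺; ∈-concatMap⁻; ∈-filter⁺; ∈-filter⁻; ∈-deduplicate⁺; ∈-deduplicate⁻)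
open import Data.List.Reverse using (Reverse; []; _∶_∶ʳ_; reverseView)
open import Data.Product using (∃-syntax; _×_; _,_; proj₁; proj₂)
open import Data.Sum as Sum using (_⊎_; inj₁; inj₂)
open import Data.Empty using (⊥-elim)
open import Function using (_∘_; _$_; id)
open import Function.Bundles using (_⇔_; mk⇔; Equivalence)
open import Function.Properties.Equivalence
  using () renaming (refl to ⇔-refl; sym to ⇔-sym; trans to ⇔-trans)
open import Relation.Nullary using (¬_; Dec; yes; no; does; ¬?)
open import Relation.Nullary.Decidable using (_⊎-dec_; _×-dec_; dec-true; dec-false; map′)
open import Relation.Binary.PropositionalEquality
  using (_≡_; _≢_; refl; sym; trans; cong; cong₂; subst; subst₂; ≢-sym; module ≡-Reasoning)
open import Relation.Binary.Definitions using (DecidableEquality)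
open import Relation.Unary using (Decidable)

module Proof {a} {A : Set a} (_≟_ : DecidableEquality A) where
  open Words _≟_ renaming (proj₂ to π)
  open import Data.List.Membership.DecPropositional _≟_ using (_∈?_)

  private variable
    x y z : A
    l m v w : List A

  -- Alternation

  record Alternating (x y : A) (w : List A) : Set a where
    constructor alternating
    field
      distinct : x ≢ y
      linked   : Linked _≢_ (π x y w)

  OnlyOf : A → A → List A → Set a
  OnlyOf x y = All (λ z → x ≡ z ⊎ y ≡ z)

  pair? : ∀ x y → Decidable (λ z → x ≡ z ⊎ y ≡ z)
  pair? x y z = (x ≟ z) ⊎-dec (y ≟ z)

  π-onlyOf : ∀ x y w → OnlyOf x y (π x y w)
  π-onlyOf x y = all-filter (pair? x y)

  π-comm : ∀ x y w → π x y w ≡ π y x w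
  π-comm x y = filter-≐ (pair? x y) (pair? y x) (Sum.swap , Sum.swap)

  π-∷-head : ∀ x y l → π x y (x ∷ l) ≡ x ∷ π x y l
  π-∷-head x y l = filter-accept (pair? x y) (inj₁ refl)

  alternating-sym : Alternating x y w → Alternating y x w
  alternating-sym {x} {y} {w} (alternating x≢y linked) =
    alternating (≢-sym x≢y) (subst (Linked _≢_) (π-comm x y w) linked)

  alternating? : ∀ x y w → Dec (Alternating x y w)
  alternating? x y w =
    map′ (λ (x≢y , linked) → alternating x≢y linked) (λ (alternating x≢y linked) → x≢y , linked)
         (¬? (x ≟ y) ×-dec Linked.linked? (λ b c → ¬? (b ≟ c)) (π x y w))

  linked-pow : x ≢ y → ∀ n → Linked _≢_ (pow x y n)
  linked-pow x≢y zero = []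
  linked-pow x≢y (suc zero) = x≢y ∷ [-]
  linked-pow x≢y (suc (suc n)) = x≢y ∷ ≢-sym x≢y ∷ linked-pow x≢y (suc n)

  linked-pow-∷ʳ : x ≢ y → ∀ n → Linked _≢_ (pow x y n ++ [ x ])
  linked-pow-∷ʳ x≢y zero = [-]
  linked-pow-∷ʳ x≢y (suc zero) = x≢y ∷ ≢-sym x≢y ∷ [-]
  linked-pow-∷ʳ x≢y (suc (suc n)) = x≢y ∷ ≢-sym x≢y ∷ linked-pow-∷ʳ x≢y (suc n)

  linked-∷⇒pow : OnlyOf x y l → Linked _≢_ (x ∷ l) →
                 ∃[ n ] (x ∷ l ≡ pow x y n ⊎ x ∷ l ≡ pow x y n ++ [ x ])
  linked-∷⇒pow [] _ = 0 , inj₂ refl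
  linked-∷⇒pow (inj₁ refl ∷ _) (x≢x ∷ _) = ⊥-elim (x≢x refl)
  linked-∷⇒pow (inj₂ refl ∷ []) _ = 1 , inj₁ refl
  linked-∷⇒pow (inj₂ refl ∷ inj₂ refl ∷ _) (_ ∷ y≢y ∷ _) = ⊥-elim (y≢y refl)
  linked-∷⇒pow {x} {y} (inj₂ refl ∷ inj₁ refl ∷ only) (_ ∷ _ ∷ linked)
    with n , eq ← linked-∷⇒pow only linked =
    suc n , Sum.map (cong (λ t → x ∷ y ∷ t)) (cong (λ t → x ∷ y ∷ t)) eq

  linked⇒pow : OnlyOf x y l → Linked _≢_ l →
    ∃[ n ] (l ≡ pow x y n ⊎ l ≡ pow x y n ++ [ x ] ⊎ l ≡ pow y x n ⊎ l ≡ pow y x n ++ [ y ])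
  linked⇒pow [] _ = 0 , inj₁ refl
  linked⇒pow (inj₁ refl ∷ only) linked
    with n , eq ← linked-∷⇒pow only linked = n , Sum.map₂ inj₁ eq
  linked⇒pow (inj₂ refl ∷ only) linked
    with n , eq ← linked-∷⇒pow (All.map Sum.swap only) linked = n , inj₂ (inj₂ eq)

  alternate⇔alternating : Alternate x y w ⇔ Alternating x y w
  alternate⇔alternating {x} {y} {w} = mk⇔ to from
    where
    to : Alternate x y w → Alternating x y w
    to (x≢y , n , inj₁ eq) =
      alternating x≢y $ subst (Linked _≢_) (sym eq) (linked-pow x≢y n)
    to (x≢y , n , inj₂ (inj₁ eq)) =
      alternating x≢y $ subst (Linked _≢_) (sym eq) (linked-pow-∷ʳ x≢y n)
    to (x≢y , n , inj₂ (inj₂ (inj₁ eq))) =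
      alternating x≢y $ subst (Linked _≢_) (sym eq) (linked-pow (≢-sym x≢y) n)
    to (x≢y , n , inj₂ (inj₂ (inj₂ eq))) =
      alternating x≢y $ subst (Linked _≢_) (sym eq) (linked-pow-∷ʳ (≢-sym x≢y) n)
    from : Alternating x y w → Alternate x y w
    from (alternating x≢y linked) = x≢y , linked⇒pow (π-onlyOf x y w) linked

  count-∷-≡ : count x (x ∷ l) ≡ suc (count x l)
  count-∷-≡ {x} = cong length (filter-accept (x ≟_) refl)

  count-∷-≢ : x ≢ z → count x (z ∷ l) ≡ count x l
  count-∷-≢ {x} x≢z = cong length (filter-reject (x ≟_) x≢z)

  count-∷∷ : x ≢ y → count x (x ∷ y ∷ l) ≡ suc (count x l)
  count-∷∷ x≢y = trans count-∷-≡ (cong suc (count-∷-≢ x≢y))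

  count-∷-≥ : ∀ z v → count z v ≤ count z (x ∷ v)
  count-∷-≥ {x} z v with z ≟ x
  ... | yes _ = n≤1+n _
  ... | no _ = ≤-refl

  count-++ : ∀ x l l′ → count x (l ++ l′) ≡ count x l + count x l′
  count-++ x l l′ = trans (cong length (filter-++ (x ≟_) l l′)) (length-++ (filter (x ≟_) l))

  count-∉ : x ∉ l → count x l ≡ 0
  count-∉ {x} {l} x∉l = cong length (filter-none (x ≟_) (¬Any⇒All¬ l x∉l))

  filter-filter-⊆ : ∀ {p q} {P : A → Set p} {Q : A → Set q} (P? : Decidable P) (Q? : Decidable Q) →
                    (∀ {z} → Q z → P z) → ∀ l → filter Q? (filter P? l) ≡ filter Q? l
  filter-filter-⊆ P? Q? Q⊆P [] = refl
  filter-filter-⊆ P? Q? Q⊆P (z ∷ l) with P? z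
  ... | no ¬Pz = trans (filter-filter-⊆ P? Q? Q⊆P l) (sym (filter-reject Q? (¬Pz ∘ Q⊆P)))
  ... | yes _ with Q? z
  ...   | yes _ = cong (z ∷_) (filter-filter-⊆ P? Q? Q⊆P l)
  ...   | no _ = filter-filter-⊆ P? Q? Q⊆P l

  count-filter : ∀ {p} {P : A → Set p} (P? : Decidable P) → P x → ∀ l →
                 count x (filter P? l) ≡ count x l
  count-filter {x} P? Px l = cong length (filter-filter-⊆ P? (x ≟_) (λ { refl → Px }) l)

  count-πˡ : ∀ x y w → count x (π x y w) ≡ count x w
  count-πˡ x y = count-filter _ (inj₁ refl)

  count-πʳ : ∀ x y w → count y (π x y w) ≡ count y w
  count-πʳ x y = count-filter _ (inj₂ refl)

  onlyOf-count : x ≢ y → OnlyOf x y l → Linked _≢_ l → count x l ≤ suc (count y l)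
  onlyOf-count x≢y [] _ = z≤n
  onlyOf-count x≢y (inj₁ refl ∷ []) _ = ≤-trans (≤-reflexive count-∷-≡) (s≤s z≤n)
  onlyOf-count x≢y (inj₁ refl ∷ inj₁ refl ∷ _) (x≢x ∷ _) = ⊥-elim (x≢x refl)
  onlyOf-count {x} {y} {_ ∷ _ ∷ l} x≢y (inj₁ refl ∷ inj₂ refl ∷ only) (_ ∷ linked) = begin
    count x (x ∷ y ∷ l)       ≡⟨ count-∷∷ x≢y ⟩
    suc (count x l)           ≤⟨ s≤s (onlyOf-count x≢y only (Linked.tail linked)) ⟩
    suc (suc (count y l))     ≡⟨ cong suc (sym (trans (count-∷-≢ (≢-sym x≢y)) count-∷-≡)) ⟩
    suc (count y (x ∷ y ∷ l)) ∎
    where open ≤-Reasoning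
  onlyOf-count {x} {y} {_ ∷ l} x≢y (inj₂ refl ∷ only) linked = begin
    count x (y ∷ l)       ≡⟨ count-∷-≢ x≢y ⟩
    count x l             ≤⟨ onlyOf-count x≢y only (Linked.tail linked) ⟩
    suc (count y l)       ≤⟨ n≤1+n _ ⟩
    suc (suc (count y l)) ≡⟨ cong suc (sym count-∷-≡) ⟩
    suc (count y (y ∷ l)) ∎
    where open ≤-Reasoning

  alternating-count : Alternating x y w → count x w ≤ suc (count y w)
  alternating-count {x} {y} {w} (alternating x≢y linked) =
    subst₂ (λ m n → m ≤ suc n) (count-πˡ x y w) (count-πʳ x y w)
           (onlyOf-count x≢y (π-onlyOf x y w) linked)

  onlyOf-rarer-not-head : x ≢ y → OnlyOf x y l → Linked _≢_ l → count x l < count y l →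
                          Connected _≢_ (just x) (head l)
  onlyOf-rarer-not-head x≢y [] _ _ = just-nothing
  onlyOf-rarer-not-head x≢y (inj₂ refl ∷ _) _ _ = just x≢y
  onlyOf-rarer-not-head {x} {y} {_ ∷ l} x≢y (inj₁ refl ∷ only) linked x<y =
    ⊥-elim (<⇒≱ x<y (begin
      count y (x ∷ l)  ≡⟨ count-∷-≢ (≢-sym x≢y) ⟩
      count y l        ≤⟨ onlyOf-count (≢-sym x≢y) (All.map Sum.swap only) (Linked.tail linked) ⟩
      suc (count x l)  ≡⟨ sym count-∷-≡ ⟩
      count x (x ∷ l)  ∎))
    where open ≤-Reasoning

  rarer-not-head : Alternating x y w → count x w < count y w →
                   Connected _≢_ (just x) (head (π x y w))
  rarer-not-head {x} {y} {w} (alternating x≢y linked) x<y =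
    onlyOf-rarer-not-head x≢y (π-onlyOf x y w) linked
      (subst₂ _<_ (sym (count-πˡ x y w)) (sym (count-πʳ x y w)) x<y)

  -- Marked blocks

  runs≤runs-false : ∀ b bs → runs b bs ≤ runs false bs
  runs≤runs-false false bs = ≤-refl
  runs≤runs-false true [] = z≤n
  runs≤runs-false true (false ∷ bs) = ≤-refl
  runs≤runs-false true (true ∷ bs) = n≤1+n _

  runs-false≤suc-runs-true : ∀ bs → runs false bs ≤ suc (runs true bs)
  runs-false≤suc-runs-true [] = z≤n
  runs-false≤suc-runs-true (false ∷ bs) = n≤1+n _
  runs-false≤suc-runs-true (true ∷ bs) = ≤-refl

  runs-mono-⊆ : ∀ b {bs cs} → bs ⊆ cs → runs b bs ≤ runs b cs
  runs-mono-⊆ b [] = z≤n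
  runs-mono-⊆ b {bs} (false ∷ʳ bs⊆cs) = ≤-trans (runs≤runs-false b bs) (runs-mono-⊆ false bs⊆cs)
  runs-mono-⊆ true (true ∷ʳ bs⊆cs) = runs-mono-⊆ true bs⊆cs
  runs-mono-⊆ false {bs} (true ∷ʳ bs⊆cs) =
    ≤-trans (runs-false≤suc-runs-true bs) (s≤s (runs-mono-⊆ true bs⊆cs))
  runs-mono-⊆ b {false ∷ _} (refl ∷ bs⊆cs) = runs-mono-⊆ false bs⊆cs
  runs-mono-⊆ true {true ∷ _} (refl ∷ bs⊆cs) = runs-mono-⊆ true bs⊆cs
  runs-mono-⊆ false {true ∷ _} (refl ∷ bs⊆cs) = s≤s (runs-mono-⊆ true bs⊆cs)

  onlyOf-count≤runs : {f : A → Bool} → f x ≡ true → f y ≡ false → x ≢ y →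
                      OnlyOf x y l → Linked _≢_ l → count x l ≤ runs false (map f l)
  onlyOf-count≤runs fx fy x≢y [] _ = z≤n
  onlyOf-count≤runs {x} {f = f} fx fy x≢y (inj₁ refl ∷ []) _ = ≤-reflexive (begin
    count x [ x ]       ≡⟨ count-∷-≡ ⟩
    1                   ≡⟨ cong (λ b → runs false [ b ]) (sym fx) ⟩
    runs false [ f x ]  ∎)
    where open ≡-Reasoning
  onlyOf-count≤runs fx fy x≢y (inj₁ refl ∷ inj₁ refl ∷ _) (x≢x ∷ _) = ⊥-elim (x≢x refl)
  onlyOf-count≤runs {x} {y} {_ ∷ _ ∷ l} {f} fx fy x≢y (inj₁ refl ∷ inj₂ refl ∷ only) (_ ∷ linked) =
    begin
    count x (x ∷ y ∷ l)             ≡⟨ count-∷∷ x≢y ⟩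
    suc (count x l)                 ≤⟨ s≤s (onlyOf-count≤runs fx fy x≢y only (Linked.tail linked)) ⟩
    suc (runs false (map f l))      ≡⟨ cong₂ (λ b c → runs false (b ∷ c ∷ map f l)) (sym fx) (sym fy) ⟩
    runs false (map f (x ∷ y ∷ l))  ∎
    where open ≤-Reasoning
  onlyOf-count≤runs {x} {y} {_ ∷ l} {f} fx fy x≢y (inj₂ refl ∷ only) linked = begin
    count x (y ∷ l)             ≡⟨ count-∷-≢ x≢y ⟩
    count x l                   ≤⟨ onlyOf-count≤runs fx fy x≢y only (Linked.tail linked) ⟩
    runs false (map f l)        ≡⟨ cong (λ c → runs false (c ∷ map f l)) (sym fy) ⟩
    runs false (map f (y ∷ l))  ∎
    where open ≤-Reasoning

  marked : List A → A → Bool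
  marked m z = does (any? (z ≟_) m)

  count≤markedBlocks : x ∈ m → y ∉ m → Alternating x y w → count x w ≤ markedBlocks m w
  count≤markedBlocks {x} {m} {y} {w} x∈m y∉m (alternating x≢y linked) = begin
    count x w                              ≡⟨ count-πˡ x y w ⟨
    count x (π x y w)                      ≤⟨ onlyOf-count≤runs (dec-true (any? _ m) x∈m)
                                                (dec-false (any? _ m) y∉m) x≢y (π-onlyOf x y w) linked ⟩
    runs false (map (marked m) (π x y w))  ≤⟨ runs-mono-⊆ false
                                                (map⁺ (marked m) (filter-⊆ (pair? x y) w)) ⟩
    runs false (map (marked m) w)          ∎
    where open ≤-Reasoning

  -- Locality

  Separates : List A → A → A → Set a
  Separates m x y = x ∈ m × y ∉ m

  separating-prefix : ∀ σ → x ∈ σ → y ∈ σ → x ≢ y →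
                      ∃[ i ] (i ≤ length σ × (Separates (take i σ) x y ⊎ Separates (take i σ) y x))
  separating-prefix {x} {y} (b ∷ σ) x∈σ y∈σ x≢y with x ≟ b | y ≟ b
  ... | yes refl | _ = 1 , s≤s z≤n , inj₁ (here refl , λ { (here y≡x) → x≢y (sym y≡x) ; (there ()) })
  ... | no _ | yes refl = 1 , s≤s z≤n , inj₂ (here refl , λ { (here x≡y) → x≢y x≡y ; (there ()) })
  ... | no x≢b | no y≢b with separating-prefix σ (Any.tail x≢b x∈σ) (Any.tail y≢b y∈σ) x≢y
  ...   | i , i≤ , separates = suc i , s≤s i≤ , Sum.map (extend y≢b) (extend x≢b) separates
    where
    extend : ∀ {m u v} → v ≢ b → Separates m u v → Separates (b ∷ m) u v
    extend v≢b (u∈m , v∉m) = there u∈m , v∉m ∘ Any.tail v≢b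

  local-count-bound : ∀ {k} → Local k w → x ∈ w → y ∈ w → Alternating x y w → count x w ≤ suc k
  local-count-bound {w} {x} {y} (σ , (_ , σ⇔w) , blocks≤k) x∈w y∈w alt
    with separating-prefix σ (Equivalence.from (σ⇔w x) x∈w) (Equivalence.from (σ⇔w y) y∈w)
                           (Alternating.distinct alt)
  ... | i , i≤ , inj₁ (x∈ , y∉) =
          m≤n⇒m≤1+n (≤-trans (count≤markedBlocks x∈ y∉ alt) (blocks≤k i i≤))
  ... | i , i≤ , inj₂ (y∈ , x∉) =
          ≤-trans (alternating-count alt)
          (s≤s (≤-trans (count≤markedBlocks y∈ x∉ (alternating-sym alt)) (blocks≤k i i≤)))

  both-false : ∀ {p q} {P : Set p} {Q : Set q} → ¬ P × ¬ Q → P ⇔ Q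
  both-false (¬p , ¬q) = mk⇔ (⊥-elim ∘ ¬p) (⊥-elim ∘ ¬q)

  represents-refl : ∀ w → Represents w (𝒢 w)
  represents-refl w = (λ _ → ⇔-refl) , λ _ _ _ _ → ⇔-refl

  represents-trans : Represents l (𝒢 v) → Represents v (𝒢 w) → Represents l (𝒢 w)
  represents-trans (l∼v , alt-l∼v) (v∼w , alt-v∼w) =
    (λ z → ⇔-trans (l∼v z) (v∼w z)) ,
    λ x y x∈w y∈w →
      ⇔-trans (alt-l∼v x y (Equivalence.from (v∼w x) x∈w) (Equivalence.from (v∼w y) y∈w))
              (alt-v∼w x y x∈w y∈w)

  represents-by-linked : (∀ z → z ∈ l ⇔ z ∈ v) →
    (∀ {x y} → x ∈ v → y ∈ v → x ≢ y → Linked _≢_ (π x y l) ⇔ Linked _≢_ (π x y v)) →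
    Represents l (𝒢 v)
  represents-by-linked {l} {v} l∼v linked⇔ = l∼v , λ x y x∈v y∈v →
    ⇔-trans alternate⇔alternating (⇔-trans (alternating⇔ x∈v y∈v) (⇔-sym alternate⇔alternating))
    where
    alternating⇔ : x ∈ v → y ∈ v → Alternating x y l ⇔ Alternating x y v
    alternating⇔ x∈v y∈v = mk⇔
      (λ (alternating x≢y linked) → alternating x≢y (Equivalence.to (linked⇔ x∈v y∈v x≢y) linked))
      (λ (alternating x≢y linked) → alternating x≢y (Equivalence.from (linked⇔ x∈v y∈v x≢y) linked))

  prepend-represents : x ∈ v →
    (∀ {y} → y ∈ v → Alternating x y v → Connected _≢_ (just x) (head (π x y v))) →
    Represents (x ∷ v) (𝒢 v)
  prepend-represents {x} {v} x∈v not-head =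
    represents-by-linked (λ z → mk⇔ (λ { (here refl) → x∈v ; (there z∈v) → z∈v }) there) linked⇔
    where
    prepend-linked : y ∈ v → x ≢ y → Linked _≢_ (π x y (x ∷ v)) ⇔ Linked _≢_ (π x y v)
    prepend-linked {y} y∈v x≢y rewrite π-∷-head x y v =
      mk⇔ Linked.tail (λ linked → not-head y∈v (alternating x≢y linked) ∷′ linked)

    -- Deciding x ≟ yᵢ rather than yᵢ ≟ x keeps the filter in the goal from being abstracted.
    linked⇔ : ∀ {y₁ y₂} → y₁ ∈ v → y₂ ∈ v → y₁ ≢ y₂ →
              Linked _≢_ (π y₁ y₂ (x ∷ v)) ⇔ Linked _≢_ (π y₁ y₂ v)
    linked⇔ {y₁} {y₂} y₁∈v y₂∈v y₁≢y₂ with x ≟ y₁ | x ≟ y₂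
    ... | yes refl | _ = prepend-linked y₂∈v y₁≢y₂
    ... | no _ | yes refl rewrite π-comm y₁ x (x ∷ v) | π-comm y₁ x v =
      prepend-linked y₁∈v (≢-sym y₁≢y₂)
    ... | no x≢y₁ | no x≢y₂
      rewrite filter-reject (pair? y₁ y₂) {xs = v} Sum.[ x≢y₁ ∘ sym , x≢y₂ ∘ sym ] = ⇔-refl

  OccursBefore : A → A → List A → Set a
  OccursBefore y x v = ∃[ t ] π x y v ≡ y ∷ t

  occursBefore-∉ : x ∉ l → y ∈ l → OccursBefore y x l
  occursBefore-∉ {x} {b ∷ l} {y} x∉l y∈l with b ≟ y
  ... | yes refl = π x y l , filter-accept (pair? x y) (inj₂ refl)
  ... | no b≢y with t , eq ← occursBefore-∉ (x∉l ∘ there) (Any.tail (b≢y ∘ sym) y∈l) =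
    t , trans (filter-reject (pair? x y) Sum.[ x∉l ∘ here , b≢y ∘ sym ]) eq

  occursBefore-++ : ∀ x v r → OccursBefore y x v → OccursBefore y x (v ++ r)
  occursBefore-++ {y} x v r (t , eq) =
    t ++ π x y r , trans (filter-++ (pair? x y) v r) (cong (_++ π x y r) eq)

  LatestFirstOccurrence : ∀ {p} → (A → Set p) → List A → A → Set (a ⊔ p)
  LatestFirstOccurrence P v x = x ∈ v × P x × (∀ {y} → y ∈ v → P y → x ≢ y → OccursBefore y x v)

  latest-first-occurrence : ∀ {p} {P : A → Set p} → Decidable P → ∀ v → Any P v →
                            ∃[ x ] LatestFirstOccurrence P v x
  latest-first-occurrence {P = P} P? v = go (reverseView v)
    where
    module _ {v z} (z-old : P z → z ∈ v) where
      earlier : y ∈ v ++ [ z ] → P y → y ∈ v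
      earlier y∈ Py with ∈-++⁻ v y∈
      ... | inj₁ y∈v = y∈v
      ... | inj₂ (here refl) = z-old Py

      restrict : Any P (v ++ [ z ]) → Any P v
      restrict any-P with y , y∈ , Py ← find any-P = lose (earlier y∈ Py) Py

      extend : ∃[ x ] LatestFirstOccurrence P v x → ∃[ x ] LatestFirstOccurrence P (v ++ [ z ]) x
      extend (x , x∈v , Px , before) = x , ∈-++⁺ˡ x∈v , Px , λ y∈ Py x≢y →
        occursBefore-++ x v [ z ] (before (earlier y∈ Py) Py x≢y)

    go : ∀ {v} → Reverse v → Any P v → ∃[ x ] LatestFirstOccurrence P v x
    go [] ()
    go (v ∶ rv ∶ʳ z) any-P with P? z | z ∈? v
    ... | yes Pz | no z∉v = z , ∈-++⁺ʳ v (here refl) , Pz , λ y∈ _ z≢y →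
      occursBefore-++ z v [ z ] (occursBefore-∉ z∉v
        (Sum.[ id , (λ { (here y≡z) → ⊥-elim (z≢y (sym y≡z)) }) ] (∈-++⁻ v y∈)))
    ... | yes _ | yes z∈v = extend (λ _ → z∈v) (go rv (restrict (λ _ → z∈v) any-P))
    ... | no ¬Pz | _ = extend (⊥-elim ∘ ¬Pz) (go rv (restrict (⊥-elim ∘ ¬Pz) any-P))

  -- Padding to a uniform word

  module Padding (K : ℕ) where

    deficit : List A → List A → ℕ
    deficit v₀ v = sum (map (λ z → K ∸ count z v) v₀)

    deficit-∷-≤ : ∀ v₀ v → deficit v₀ (x ∷ v) ≤ deficit v₀ v
    deficit-∷-≤ [] v = z≤n
    deficit-∷-≤ (z ∷ v₀) v = +-mono-≤ (∸-monoʳ-≤ K (count-∷-≥ z v)) (deficit-∷-≤ v₀ v)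

    deficit-∷-< : ∀ v₀ v → x ∈ v₀ → count x v < K → deficit v₀ (x ∷ v) < deficit v₀ v
    deficit-∷-< (z ∷ v₀) v (here refl) x<K =
      +-mono-<-≤ (subst (λ n → K ∸ n < K ∸ count z v) (sym count-∷-≡) (∸-monoʳ-< (n<1+n _) x<K))
                 (deficit-∷-≤ v₀ v)
    deficit-∷-< (z ∷ v₀) v (there x∈v₀) x<K =
      +-mono-≤-< (∸-monoʳ-≤ K (count-∷-≥ z v)) (deficit-∷-< v₀ v x∈v₀ x<K)

    bounded-∷ : count x v < K → (∀ {z} → z ∈ v → count z v ≤ K) →
                ∀ {z} → z ∈ x ∷ v → count z (x ∷ v) ≤ K
    bounded-∷ {x} x<K bounded {z} z∈ with x ≟ z
    ... | yes refl = ≤-trans (≤-reflexive count-∷-≡) x<K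
    ... | no x≢z = ≤-trans (≤-reflexive (count-∷-≢ (x≢z ∘ sym))) (bounded (Any.tail (x≢z ∘ sym) z∈))

    pad-from : ∀ v₀ v → Acc _<_ (deficit v₀ v) → (∀ {z} → z ∈ v → z ∈ v₀) →
               (∀ {z} → z ∈ v → count z v ≤ K) → ∃[ u ] (Uniform K u × Represents u (𝒢 v))
    pad-from v₀ v (acc smaller) v⊆v₀ bounded with any? (λ z → count z v <? K) v
    ... | no none-deficient =
      v , (λ z z∈v → ≤-antisym (bounded z∈v) (≮⇒≥ (none-deficient ∘ lose z∈v))) , represents-refl v
    ... | yes some-deficient with latest-first-occurrence (λ z → count z v <? K) v some-deficient
    ...   | x , x∈v , x<K , latest =
      let u , uniform , u∼xv = pad-from v₀ (x ∷ v) (smaller (deficit-∷-< v₀ v (v⊆v₀ x∈v) x<K))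
                                        (λ { (here refl) → v⊆v₀ x∈v ; (there z∈v) → v⊆v₀ z∈v })
                                        (bounded-∷ x<K bounded)
      in u , uniform , represents-trans u∼xv (prepend-represents x∈v not-head)
      where
      not-head : y ∈ v → Alternating x y v → Connected _≢_ (just x) (head (π x y v))
      not-head {y} y∈v alt with count y v <? K
      ... | yes y<K with t , eq ← latest y∈v y<K (Alternating.distinct alt) =
        subst (Connected _≢_ (just x) ∘ head) (sym eq) (just (Alternating.distinct alt))
      ... | no y≮K = rarer-not-head alt (<-≤-trans x<K (≮⇒≥ y≮K))

    pad : ∀ v → (∀ {z} → z ∈ v → count z v ≤ K) → ∃[ u ] (Uniform K u × Represents u (𝒢 v))
    pad v = pad-from v v (<-wellFounded _) id

  -- Isolated letters

  doubled : List A → List A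
  doubled = concatMap (λ z → z ∷ z ∷ [])

  ∈-doubled⁺ : z ∈ l → z ∈ doubled l
  ∈-doubled⁺ = ∈-concatMap⁺ _ ∘ Any.map here

  ∈-doubled⁻ : ∀ l → z ∈ doubled l → z ∈ l
  ∈-doubled⁻ l =
    Any.map (λ { (here z≡b) → z≡b ; (there (here z≡b)) → z≡b }) ∘ ∈-concatMap⁻ _ {xs = l}

  count-doubled : Unique l → count z (doubled l) ≤ 2
  count-doubled [] = z≤n
  count-doubled {b ∷ l} {z} (b∉l ∷ unique) with b ≟ z
  ... | yes refl = ≤-reflexive (trans count-∷-≡ (cong suc (trans count-∷-≡
                     (cong suc (count-∉ (All¬⇒¬Any b∉l ∘ ∈-doubled⁻ l))))))
  ... | no b≢z = ≤-trans (≤-reflexive (trans (count-∷-≢ (b≢z ∘ sym)) (count-∷-≢ (b≢z ∘ sym))))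
                         (count-doubled unique)

  doubled-stutter : z ∈ l → ∃[ l₁ ] ∃[ l₂ ] doubled l ≡ l₁ ++ z ∷ z ∷ l₂
  doubled-stutter {l = _ ∷ l} (here refl) = [] , doubled l , refl
  doubled-stutter {l = b ∷ _} (there z∈l) with l₁ , l₂ , eq ← doubled-stutter z∈l =
    b ∷ b ∷ l₁ , l₂ , cong (λ t → b ∷ b ∷ t) eq

  stutter-not-linked : ∀ l {l′} → ¬ Linked _≢_ (l ++ z ∷ z ∷ l′)
  stutter-not-linked [] (z≢z ∷ _) = z≢z refl
  stutter-not-linked (_ ∷ l) linked = stutter-not-linked l (Linked.tail linked)

  π-stutter-not-linked : ∀ y l l′ → ¬ Linked _≢_ (π x y (l ++ x ∷ x ∷ l′))
  π-stutter-not-linked {x} y l l′ = stutter-not-linked (π x y l) ∘ subst (Linked _≢_) π-stutter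
    where
    π-stutter : π x y (l ++ x ∷ x ∷ l′) ≡ π x y l ++ x ∷ x ∷ π x y l′
    π-stutter = trans (filter-++ (pair? x y) l _)
                      (cong (π x y l ++_) (trans (π-∷-head x y _) (cong (x ∷_) (π-∷-head x y l′))))

  module Isolation (w : List A) where

    NonIsolated : A → Set a
    NonIsolated x = Any (λ y → Alternating x y w) w

    nonIsolated? : Decidable NonIsolated
    nonIsolated? x = any? (λ y → alternating? x y w) w

    core : List A
    core = filter nonIsolated? w

    isolated : List A
    isolated = deduplicate _≟_ (filter (¬? ∘ nonIsolated?) w)

    condensed : List A
    condensed = core ++ doubled isolated

    isolated-unique : Unique isolated
    isolated-unique = Unique.deduplicate-! _≟_ _

    ∈-isolated⁺ : z ∈ w → ¬ NonIsolated z → z ∈ isolated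
    ∈-isolated⁺ z∈w iso = ∈-deduplicate⁺ _≟_ (∈-filter⁺ (¬? ∘ nonIsolated?) z∈w iso)

    ∈-isolated⁻ : z ∈ isolated → z ∈ w × ¬ NonIsolated z
    ∈-isolated⁻ = ∈-filter⁻ (¬? ∘ nonIsolated?) ∘ ∈-deduplicate⁻ _≟_ _

    nonIsolated-∉ : NonIsolated z → z ∉ doubled isolated
    nonIsolated-∉ ni z∈ = proj₂ (∈-isolated⁻ (∈-doubled⁻ isolated z∈)) ni

    ∈-condensed : ∀ z → z ∈ condensed ⇔ z ∈ w
    ∈-condensed z = mk⇔ to from
      where
      to : z ∈ condensed → z ∈ w
      to z∈ = Sum.[ proj₁ ∘ ∈-filter⁻ nonIsolated? {xs = w}
                  , proj₁ ∘ ∈-isolated⁻ ∘ ∈-doubled⁻ isolated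
                  ] (∈-++⁻ core z∈)
      from : z ∈ w → z ∈ condensed
      from z∈w with nonIsolated? z
      ... | yes ni = ∈-++⁺ˡ (∈-filter⁺ nonIsolated? z∈w ni)
      ... | no iso = ∈-++⁺ʳ core (∈-doubled⁺ (∈-isolated⁺ z∈w iso))

    condensed-bounded : ∀ {K} → 2 ≤ K →
                        (∀ {x y} → x ∈ w → y ∈ w → Alternating x y w → count x w ≤ K) →
                        ∀ {z} → z ∈ condensed → count z condensed ≤ K
    condensed-bounded {K} 2≤K bound {z} z∈ with nonIsolated? z
    ... | yes ni with y , y∈w , alt ← find ni = begin
      count z condensed                          ≡⟨ count-++ z core _ ⟩
      count z core + count z (doubled isolated)  ≡⟨ cong₂ _+_ (count-filter nonIsolated? ni w)
                                                              (count-∉ (nonIsolated-∉ ni)) ⟩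
      count z w + 0                              ≡⟨ +-identityʳ _ ⟩
      count z w                                  ≤⟨ bound (Equivalence.to (∈-condensed z) z∈) y∈w alt ⟩
      K                                          ∎
      where open ≤-Reasoning
    ... | no iso = let z∉core = iso ∘ proj₂ ∘ ∈-filter⁻ nonIsolated? {xs = w} in begin
      count z condensed                          ≡⟨ count-++ z core _ ⟩
      count z core + count z (doubled isolated)  ≡⟨ cong (_+ count z (doubled isolated))
                                                      (count-∉ {l = core} z∉core) ⟩
      count z (doubled isolated)                 ≤⟨ count-doubled isolated-unique ⟩
      2                                          ≤⟨ 2≤K ⟩
      K                                          ∎
      where open ≤-Reasoning

    isolated-not-linked : ¬ NonIsolated x → x ∈ w → y ∈ w → x ≢ y →
                          ¬ Linked _≢_ (π x y condensed) × ¬ Linked _≢_ (π x y w)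
    isolated-not-linked {x} {y} iso x∈w y∈w x≢y
      with l₁ , l₂ , eq ← doubled-stutter (∈-isolated⁺ x∈w iso) =
      π-stutter-not-linked y (core ++ l₁) l₂ ∘ subst (Linked _≢_ ∘ π x y) regroup ,
      λ linked → iso (lose y∈w (alternating x≢y linked))
      where
      regroup : condensed ≡ (core ++ l₁) ++ x ∷ x ∷ l₂
      regroup = trans (cong (core ++_) eq) (sym (++-assoc core l₁ _))

    π-condensed : NonIsolated x → NonIsolated y → π x y condensed ≡ π x y w
    π-condensed {x} {y} nx ny = begin
      π x y (core ++ doubled isolated)        ≡⟨ filter-++ (pair? x y) core _ ⟩
      π x y core ++ π x y (doubled isolated)  ≡⟨ cong₂ _++_
                                                   (filter-filter-⊆ nonIsolated? (pair? x y) in-core w)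
                                                   (filter-none (pair? x y) (All.tabulate not-doubled)) ⟩
      π x y w ++ []                           ≡⟨ ++-identityʳ _ ⟩
      π x y w                                 ∎
      where
      open ≡-Reasoning
      in-core : ∀ {z} → x ≡ z ⊎ y ≡ z → NonIsolated z
      in-core = Sum.[ (λ { refl → nx }) , (λ { refl → ny }) ]
      not-doubled : ∀ {z} → z ∈ doubled isolated → ¬ (x ≡ z ⊎ y ≡ z)
      not-doubled z∈ = Sum.[ (λ { refl → nonIsolated-∉ nx z∈ }) , (λ { refl → nonIsolated-∉ ny z∈ }) ]

    condensed-linked⇔ : x ∈ w → y ∈ w → x ≢ y →
                        Linked _≢_ (π x y condensed) ⇔ Linked _≢_ (π x y w)
    condensed-linked⇔ {x} {y} x∈w y∈w x≢y with nonIsolated? x | nonIsolated? y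
    ... | yes nx | yes ny rewrite π-condensed nx ny = ⇔-refl
    ... | no ix | _ = both-false (isolated-not-linked ix x∈w y∈w x≢y)
    ... | _ | no iy rewrite π-comm x y condensed | π-comm x y w =
      both-false (isolated-not-linked iy y∈w x∈w (≢-sym x≢y))

    isolate : ∀ {K} → 2 ≤ K → (∀ {x y} → x ∈ w → y ∈ w → Alternating x y w → count x w ≤ K) →
              ∃[ w′ ] ((∀ {z} → z ∈ w′ → count z w′ ≤ K) × Represents w′ (𝒢 w))
    isolate 2≤K bound =
      condensed , condensed-bounded 2≤K bound , represents-by-linked ∈-condensed condensed-linked⇔

mainTheorem1 : {a : Level} {A : Set a} (_≟_ : DecidableEquality A) →
    (k : ℕ) → k ≥ 1 → (w : List A) →
    Words.Local _≟_ k w → Words.Representable _≟_ (suc k) (Words.𝒢 _≟_ w)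
mainTheorem1 _≟_ k k≥1 w local =
  let w′ , bounded , w′∼w = Isolation.isolate w (s≤s k≥1) (local-count-bound local)
      u , uniform , u∼w′ = Padding.pad (suc k) w′ bounded
  in u , uniform , represents-trans u∼w′ w′∼w
  where open Proof _≟_
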